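{- Let $q,m\geq 0$ be rational numbers, $P=[0,q]$ and $Q=[0,m]$ intervals in $\mathbb{R}$, with $q\geq\min\{1,m\}$. Then the pair $(Q,P)$ is convex-normal, i.e. $Q+P=G(Q)+P$.
   Context: For a polytope $Q$ with vertex set $\mathrm{ver}(Q)$ set $G(Q):=\bigcup_{v\in\mathrm{ver}(Q)}\big((v+\mathbb{Z}^d)\cap Q\big)$ (here $d=1$). A pair of polytopes $(Q,P)$ is convex-normal if $Q+P=G(Q)+P$ (Minkowski sums).
   Formalization: The intervals P and Q, the set G(Q) and both Minkowski sums are taken as subsets of ℚ rather than of ℝ. -}

module Defs where

open import Level using (0ℓ)
open import Data.Integer using (ℤ)
open import Data.Rational using (ℚ; _+_; _≤_; _/_; 0ℚ)
open import Data.Product using (Σ; _×_; ∃)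
open import Data.Sum using (_⊎_)
open import Relation.Binary.PropositionalEquality using (_≡_)
open import Relation.Unary using (Pred)

Set¹ : Set₁
Set¹ = Pred ℚ 0ℓ

Icc : ℚ → ℚ → Set¹
Icc a b x = a ≤ x × x ≤ b

ℤ→ℚ : ℤ → ℚ
ℤ→ℚ k = k / 1

_⊕_ : Set¹ → Set¹ → Set¹
(A ⊕ B) x = Σ ℚ λ a → Σ ℚ λ b → A a × B b × x ≡ a + b

_≐_ : Set¹ → Set¹ → Set
A ≐ B = ∀ x → (A x → B x) × (B x → A x)

-- For the interval Q = [a , b] (a ≤ b) with vertex set {a , b}:
-- G(Q) = ((a + ℤ) ∩ Q) ∪ ((b + ℤ) ∩ Q).
G-Icc : ℚ → ℚ → Set¹
G-Icc a b x = Icc a b x × (∃ λ (k : ℤ) → x ≡ a + ℤ→ℚ k ⊎ x ≡ b + ℤ→ℚ k)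

ConvexNormal-Icc : ℚ → ℚ → Set¹ → Set
ConvexNormal-Icc a b P = (Icc a b ⊕ P) ≐ (G-Icc a b ⊕ P)

-- Every point x of [a, b] + [0, q] = [a, b + q] lies in [g, g + q] for some g ∈ G([a, b]).
-- If b − a ≤ q the two vertices suffice, since [a, a + q] ∪ [b, b + q] = [a, b + q].
-- Otherwise min(1, b − a) ≤ q forces 1 ≤ q: the vertex b covers [b, b + q], and every
-- x ∈ [a, b] lies at distance at most 1 above the point a + ⌊x − a⌋ of (a + ℤ) ∩ [a, b].
module Submission where

open import Defs
open import Data.Rational using (ℚ; _≤_; _⊓_; 0ℚ; 1ℚ)
open import Data.Rational.Base using (mkℚ; _+_; _-_; -_; *≤*; nonNegative)
open import Data.Rational.Properties
  using ( ≤-refl; ≤-trans; <⇒≤; ≰⇒>; _≤?_; +-mono-≤; +-monoˡ-≤; +-monoʳ-≤; +-comm; +-assoc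
        ; +-identityʳ; +-inverseˡ; +-inverseʳ; ⊓-sel; nonNegative⁻¹; normalize-coprime
        ; normalize-nonNeg; +-0-abelianGroup)
open import Algebra.Properties.AbelianGroup +-0-abelianGroup
  using (\\-leftDividesʳ; //-rightDividesˡ)
open import Data.Integer.Base as ℤ using (+_)
import Data.Integer.Properties as ℤ
open import Data.Nat.Base as ℕ using (ℕ; suc)
import Data.Nat.Properties as ℕ
open import Data.Nat.DivMod using (m≡m%n+[m/n]*n; m%n<n; m/n*n≤m)
open import Data.Nat.Coprimality using (Coprime; 1-coprimeTo) renaming (sym to coprime-sym)
open import Data.Product using (Σ; _,_; proj₁)
open import Data.Sum using (_⊎_; inj₁; inj₂)
open import Relation.Binary.PropositionalEquality
  using (_≡_; refl; sym; trans; cong; subst; subst₂)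
open import Relation.Nullary using (yes; no)
open import Relation.Unary using (_⊆_)

private
  variable
    a b c g p q r x : ℚ
    A A′ B : Set¹

p⊓q≤r⇒p≤r⊎q≤r : p ⊓ q ≤ r → p ≤ r ⊎ q ≤ r
p⊓q≤r⇒p≤r⊎q≤r {p} {q} h with ⊓-sel p q
... | inj₁ p⊓q≡p = inj₁ (subst (_≤ _) p⊓q≡p h)
... | inj₂ p⊓q≡q = inj₂ (subst (_≤ _) p⊓q≡q h)

p+[q-p]≡q : ∀ p q → p + (q - p) ≡ q
p+[q-p]≡q p q = trans (+-comm p (q - p)) (//-rightDividesˡ p q)

p≤q⇒0≤q-p : p ≤ q → 0ℚ ≤ q - p
p≤q⇒0≤q-p {p} {q} p≤q = subst (_≤ q - p) (+-inverseʳ p) (+-monoˡ-≤ (- p) p≤q)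

p-q≤r⇒p≤q+r : p - q ≤ r → p ≤ q + r
p-q≤r⇒p≤q+r {p} {q} {r} h = subst (_≤ q + r) (p+[q-p]≡q q p) (+-monoʳ-≤ q h)

ℤ→ℚ-+≡mkℚ : ∀ k → ℤ→ℚ (+ k) ≡ mkℚ (+ k) 0 (coprime-sym (1-coprimeTo k))
ℤ→ℚ-+≡mkℚ k = normalize-coprime _

0≤ℤ→ℚ-+ : ∀ k → 0ℚ ≤ ℤ→ℚ (+ k)
0≤ℤ→ℚ-+ k = nonNegative⁻¹ _ {{normalize-nonNeg k 1}}

ℤ→ℚ-+-suc : ∀ k → ℤ→ℚ (+ suc k) ≡ ℤ→ℚ (+ k) + 1ℚ
ℤ→ℚ-+-suc k rewrite ℤ→ℚ-+≡mkℚ k =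
  sym (trans (cong (λ i → ℤ→ℚ (i ℤ.+ + 1)) (ℤ.*-identityʳ (+ k)))
             (cong (λ n → ℤ→ℚ (+ n)) (ℕ.+-comm k 1)))

ℤ→ℚ-+-≤-mkℚ : ∀ {k n d-1} .{cop : Coprime n (suc d-1)} →
              k ℕ.* suc d-1 ℕ.≤ n → ℤ→ℚ (+ k) ≤ mkℚ (+ n) d-1 cop
ℤ→ℚ-+-≤-mkℚ {k} {n} {d-1} h rewrite ℤ→ℚ-+≡mkℚ k =
  *≤* (subst₂ ℤ._≤_ (ℤ.pos-* k (suc d-1)) (sym (ℤ.*-identityʳ (+ n))) (ℤ.+≤+ h))

mkℚ-≤-ℤ→ℚ-+ : ∀ {k n d-1} .{cop : Coprime n (suc d-1)} →
              n ℕ.≤ k ℕ.* suc d-1 → mkℚ (+ n) d-1 cop ≤ ℤ→ℚ (+ k)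
mkℚ-≤-ℤ→ℚ-+ {k} {n} {d-1} h rewrite ℤ→ℚ-+≡mkℚ k =
  *≤* (subst₂ ℤ._≤_ (sym (ℤ.*-identityʳ (+ n))) (ℤ.pos-* k (suc d-1)) (ℤ.+≤+ h))

ℕ-floor : 0ℚ ≤ x → Σ ℕ λ k → Icc (ℤ→ℚ (+ k)) (ℤ→ℚ (+ k) + 1ℚ) x
ℕ-floor {mkℚ ℤ.-[1+ _ ] _ _} 0≤x with () ← nonNegative 0≤x
ℕ-floor {x@(mkℚ (+ n) d-1 _)} _ =
  k , ℤ→ℚ-+-≤-mkℚ {k} (m/n*n≤m n d)
    , subst (x ≤_) (ℤ→ℚ-+-suc k) (mkℚ-≤-ℤ→ℚ-+ {suc k} n≤[1+k]d)
  where
  d = suc d-1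
  k = n ℕ./ d
  n≤[1+k]d : n ℕ.≤ suc k ℕ.* d
  n≤[1+k]d = subst (ℕ._≤ suc k ℕ.* d) (sym (m≡m%n+[m/n]*n n d))
                   (ℕ.+-monoˡ-≤ (k ℕ.* d) (ℕ.<⇒≤ (m%n<n n d)))

⊕-monoˡ : A ⊆ A′ → (A ⊕ B) ⊆ (A′ ⊕ B)
⊕-monoˡ A⊆A′ (a , b , a∈A , b∈B , x≡a+b) = a , b , A⊆A′ a∈A , b∈B , x≡a+b

∈-⊕-by-difference : A g → B (x - g) → (A ⊕ B) x
∈-⊕-by-difference {g = g} {x = x} g∈A x-g∈B = g , x - g , g∈A , x-g∈B , sym (p+[q-p]≡q g x)

Icc-monoʳ : b ≤ c → Icc a b ⊆ Icc a c
Icc-monoʳ b≤c (a≤x , x≤b) = a≤x , ≤-trans x≤b b≤c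

Icc-translate : ∀ c → Icc a b x → Icc (c + a) (c + b) (c + x)
Icc-translate c (a≤x , x≤b) = +-monoʳ-≤ c a≤x , +-monoʳ-≤ c x≤b

Icc-shift-to-0 : Icc g (g + c) x → Icc 0ℚ c (x - g)
Icc-shift-to-0 {g} {c} {x} x∈ =
  subst₂ (λ l u → Icc l u (x - g)) (+-inverseˡ g) (\\-leftDividesʳ g c)
    (subst (Icc (- g + g) (- g + (g + c))) (+-comm (- g) x) (Icc-translate (- g) x∈))

Icc⊕Icc₀⊆Icc : (Icc a b ⊕ Icc 0ℚ q) ⊆ Icc a (b + q)
Icc⊕Icc₀⊆Icc {a} {x = x} (a′ , b′ , (a≤a′ , a′≤b) , (0≤b′ , b′≤q) , x≡a′+b′) =
  subst (Icc a _) (sym x≡a′+b′)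
    (subst (_≤ a′ + b′) (+-identityʳ a) (+-mono-≤ a≤a′ 0≤b′) , +-mono-≤ a′≤b b′≤q)

G-Icc⊆Icc : G-Icc a b ⊆ Icc a b
G-Icc⊆Icc (x∈ , _) = x∈

left-vertex∈G-Icc : a ≤ b → G-Icc a b a
left-vertex∈G-Icc {a} a≤b = (≤-refl , a≤b) , + 0 , inj₁ (sym (+-identityʳ a))

right-vertex∈G-Icc : a ≤ b → G-Icc a b b
right-vertex∈G-Icc {b = b} a≤b = (a≤b , ≤-refl) , + 0 , inj₂ (sym (+-identityʳ b))

ℕ-translate∈G-Icc : ∀ k → a + ℤ→ℚ (+ k) ≤ b → G-Icc a b (a + ℤ→ℚ (+ k))
ℕ-translate∈G-Icc {a} k a+k≤b =
  (a≤a+k , a+k≤b) , + k , inj₁ refl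
  where
  a≤a+k : a ≤ a + ℤ→ℚ (+ k)
  a≤a+k = subst (_≤ a + ℤ→ℚ (+ k)) (+-identityʳ a) (+-monoʳ-≤ a (0≤ℤ→ℚ-+ k))

Icc-above⊆G-Icc⊕Icc₀ : G-Icc a b g → Icc g (g + q) ⊆ (G-Icc a b ⊕ Icc 0ℚ q)
Icc-above⊆G-Icc⊕Icc₀ g∈G x∈ = ∈-⊕-by-difference g∈G (Icc-shift-to-0 x∈)

1≤q⇒Icc⊆G-Icc⊕Icc₀ : 1ℚ ≤ q → Icc a b ⊆ (G-Icc a b ⊕ Icc 0ℚ q)
1≤q⇒Icc⊆G-Icc⊕Icc₀ {a = a} 1≤q {x} (a≤x , x≤b) with ℕ-floor (p≤q⇒0≤q-p a≤x)
... | k , x-a∈[k,k+1] =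
  ∈-⊕-by-difference (ℕ-translate∈G-Icc k (≤-trans (proj₁ x∈[a+k,a+k+1]) x≤b))
                    (Icc-monoʳ 1≤q (Icc-shift-to-0 x∈[a+k,a+k+1]))
  where
  a+k = a + ℤ→ℚ (+ k)
  x∈[a+k,a+k+1] : Icc a+k (a+k + 1ℚ) x
  x∈[a+k,a+k+1] = subst₂ (Icc a+k) (sym (+-assoc a (ℤ→ℚ (+ k)) 1ℚ)) (p+[q-p]≡q a x)
                    (Icc-translate a x-a∈[k,k+1])

Icc[a,b+q]⊆G-Icc⊕Icc₀ : a ≤ b → 1ℚ ≤ q ⊎ b - a ≤ q → Icc a (b + q) ⊆ (G-Icc a b ⊕ Icc 0ℚ q)
Icc[a,b+q]⊆G-Icc⊕Icc₀ {b = b} a≤b (inj₁ 1≤q) {x} (a≤x , x≤b+q) with x ≤? b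
... | yes x≤b = 1≤q⇒Icc⊆G-Icc⊕Icc₀ 1≤q (a≤x , x≤b)
... | no  x≰b = Icc-above⊆G-Icc⊕Icc₀ (right-vertex∈G-Icc a≤b) (<⇒≤ (≰⇒> x≰b) , x≤b+q)
Icc[a,b+q]⊆G-Icc⊕Icc₀ {a} {q = q} a≤b (inj₂ b-a≤q) {x} (a≤x , x≤b+q) with x ≤? a + q
... | yes x≤a+q = Icc-above⊆G-Icc⊕Icc₀ (left-vertex∈G-Icc a≤b) (a≤x , x≤a+q)
... | no  x≰a+q = Icc-above⊆G-Icc⊕Icc₀ (right-vertex∈G-Icc a≤b)
                    (≤-trans (p-q≤r⇒p≤q+r b-a≤q) (<⇒≤ (≰⇒> x≰a+q)) , x≤b+q)

Icc⊕Icc₀⊆G-Icc⊕Icc₀ : 1ℚ ⊓ (b - a) ≤ q → (Icc a b ⊕ Icc 0ℚ q) ⊆ (G-Icc a b ⊕ Icc 0ℚ q)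
Icc⊕Icc₀⊆G-Icc⊕Icc₀ h x∈@(_ , _ , (a≤a′ , a′≤b) , _) =
  Icc[a,b+q]⊆G-Icc⊕Icc₀ (≤-trans a≤a′ a′≤b) (p⊓q≤r⇒p≤r⊎q≤r h) (Icc⊕Icc₀⊆Icc x∈)

convexNormal-Icc-Icc₀ : 1ℚ ⊓ (b - a) ≤ q → ConvexNormal-Icc a b (Icc 0ℚ q)
convexNormal-Icc-Icc₀ h _ = Icc⊕Icc₀⊆G-Icc⊕Icc₀ h , ⊕-monoˡ G-Icc⊆Icc

-- The nonnegativity hypotheses are superfluous: if q < 0 or m < 0, both sums are empty.
mainTheorem7 : (q m : ℚ) → 0ℚ ≤ q → 0ℚ ≤ m → 1ℚ ⊓ m ≤ q →
    ConvexNormal-Icc 0ℚ m (Icc 0ℚ q)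
mainTheorem7 q m _ _ 1⊓m≤q =
  convexNormal-Icc-Icc₀ (subst (λ d → 1ℚ ⊓ d ≤ q) (sym (+-identityʳ m)) 1⊓m≤q)
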